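{- Let $n \geq 6$ be an even integer and suppose that $n$ has an odd prime factor $p$ with $p \leq \lceil \log_2 n \rceil$ such that $2$ is a primitive root modulo $p$. Then $\gamma(KG_n) \leq \frac{n}{p}$.
   Context: For even $n \geq 6$, the Knödel graph $KG_n$ has vertex set $\{0,1,\dots,n-1\}$, and $\{x,y\}$ is an edge if and only if $x + y \equiv 2^t - 1 \pmod n$ for some $t \in \{1,2,\dots,\lfloor \log_2 n\rfloor\}$. A dominating set of a graph $G$ is a set $D$ of vertices such that every vertex is in $D$ or adjacent to a vertex of $D$; $\gamma(G)$ denotes the minimum size of a dominating set. -}

module Defs where

open import Data.Nat using (ℕ; zero; suc; _+_; _*_; _∸_; _^_; _≤_; _<_; NonZero)
open import Data.Nat.DivMod using (_%_)
open import Data.Nat.Logarithm using (⌊log₂_⌋)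
open import Data.Fin using (Fin; toℕ)
open import Data.List using (List; length)
open import Data.List.Membership.Propositional using (_∈_)
open import Data.List.Relation.Unary.Unique.Propositional using (Unique)
open import Data.Product using (Σ; ∃; _×_)
open import Data.Sum using (_⊎_)
open import Relation.Binary.PropositionalEquality using (_≡_; _≢_)

KGAdj : (n : ℕ) .{{_ : NonZero n}} → Fin n → Fin n → Set
KGAdj n x y = ∃ λ t → (1 ≤ t) × (t ≤ ⌊log₂ n ⌋)
                × ((toℕ x + toℕ y) % n ≡ (2 ^ t ∸ 1) % n)

IsDominatingKG : (n : ℕ) .{{_ : NonZero n}} → List (Fin n) → Set
IsDominatingKG n D = (v : Fin n) → (v ∈ D) ⊎ (∃ λ u → (u ∈ D) × KGAdj n u v)

γKG≤ : (n : ℕ) .{{_ : NonZero n}} → ℕ → Set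
γKG≤ n k = ∃ λ (D : List (Fin n)) → Unique D × IsDominatingKG n D × (length D ≤ k)

TwoPrimitiveRootMod : (p : ℕ) .{{_ : NonZero p}} → Set
TwoPrimitiveRootMod p = ((2 ^ (p ∸ 1)) % p ≡ 1)
  × ((k : ℕ) → 1 ≤ k → k < p ∸ 1 → (2 ^ k) % p ≢ 1)

-- Write p = 2c + 1. The n/p vertices congruent to c modulo p dominate KG_n; since p ∣ n,
-- adjacency u + v ≡ 2^t − 1 (mod n) can be read modulo p. If v + c + 1 ≡ 0 (mod p) then
-- v ≡ c already. Otherwise v + c + 1 is a unit modulo p, and because 2 is a primitive root
-- it equals 2^t for some 1 ≤ t ≤ p − 1 ≤ ⌊log₂ n⌋; the neighbour u ≡ 2^t − 1 − v (mod n)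
-- of v then satisfies u ≡ c (mod p).

module Submission where

open import Defs
open import Data.Nat using (ℕ; _≤_; NonZero)
open import Data.Nat.DivMod using (_/_)
open import Data.Nat.Divisibility using (_∣_)
open import Data.Nat.Primality using (Prime)
open import Data.Nat.Logarithm using (⌈log₂_⌉)
open import Relation.Binary.PropositionalEquality using (_≢_)

open import Data.Nat using (nonTrivial⇒≢1; nonTrivial⇒n>1; zero; suc; z<s; _+_; _*_; _∸_; _^_; _<_; z≤n; s≤s; _≟_; _≤?_)
open import Data.Nat.Properties
open import Data.Nat.DivMod
open import Data.Nat.Divisibility using (n∣m*n; m%n≡0⇒n∣m; ∣1⇒≡1)
open import Data.Nat.Primality using (euclidsLemma; prime[2]; prime⇒nonTrivial; prime⇒irreducible)
open import Data.Nat.Logarithm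
open import Data.Nat.Tactic.RingSolver using (solve-∀)
open import Data.Fin as Fin using (Fin; toℕ; fromℕ<; punchOut)
open import Data.Fin.Properties using (toℕ<n; toℕ-fromℕ<; toℕ-injective; punchOut-injective; injective⇒≤; any?)
open import Data.List using (List; map; allFin; length)
open import Data.List.Membership.Propositional using (_∈_)
open import Data.List.Membership.Propositional.Properties using (∈-map⁺; ∈-allFin)
open import Data.List.Properties using (length-map; length-tabulate)
open import Data.List.Relation.Unary.Unique.Propositional using (Unique)
open import Data.List.Relation.Unary.Unique.Propositional.Properties using (allFin⁺; map⁺)
open import Data.Product using (∃; _,_; _×_; proj₂; map₂)
open import Data.Sum using (inj₁; inj₂)
open import Function.Definitions using (Injective)
open import Relation.Nullary using (yes; no; contradiction)
open import Relation.Binary.PropositionalEquality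
  using (_≡_; refl; sym; trans; cong; cong₂; subst; module ≡-Reasoning)

injective⇒surjective : ∀ {m} {f : Fin m → Fin m} → Injective _≡_ _≡_ f →
                       ∀ b → ∃ λ a → f a ≡ b
injective⇒surjective {zero} _ ()
injective⇒surjective {suc m} {f} f-inj b with any? (λ a → f a Fin.≟ b)
... | yes hit = hit
... | no ¬hit = contradiction (injective⇒≤ g-inj) (n≮n m)
  where
  b≢f : ∀ a → b ≢ f a
  b≢f a b≡fa = ¬hit (a , sym b≡fa)
  g : Fin (suc m) → Fin m
  g a = punchOut (b≢f a)
  g-inj : Injective _≡_ _≡_ g
  g-inj {x} {y} gx≡gy = f-inj (punchOut-injective (b≢f x) (b≢f y) gx≡gy)

injective⇒hitsAllBut : ∀ {m} {f : Fin m → Fin (suc m)} {a} → Injective _≡_ _≡_ f →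
                       (∀ k → a ≢ f k) → ∀ {b} → a ≢ b → ∃ λ k → f k ≡ b
injective⇒hitsAllBut {m} {f} f-inj a≢f a≢b =
  map₂ (λ {k} → punchOut-injective (a≢f k) a≢b) (injective⇒surjective g-inj (punchOut a≢b))
  where
  g : Fin m → Fin m
  g k = punchOut (a≢f k)
  g-inj : Injective _≡_ _≡_ g
  g-inj {x} {y} gx≡gy = f-inj (punchOut-injective (a≢f x) (a≢f y) gx≡gy)

module _ (p : ℕ) .{{_ : NonZero p}} where

  %-≡⇒∣∸ : ∀ a b → a % p ≡ b % p → p ∣ b ∸ a
  %-≡⇒∣∸ a b a≡b = subst (p ∣_) (sym b∸a≡) (n∣m*n (b / p ∸ a / p))
    where
    open ≡-Reasoning
    b∸a≡ : b ∸ a ≡ (b / p ∸ a / p) * p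
    b∸a≡ = begin
      b ∸ a                                     ≡⟨ cong₂ _∸_ (m≡m%n+[m/n]*n b p) (m≡m%n+[m/n]*n a p) ⟩
      (b % p + b / p * p) ∸ (a % p + a / p * p) ≡⟨ cong (λ r → (b % p + b / p * p) ∸ (r + a / p * p)) a≡b ⟩
      (b % p + b / p * p) ∸ (b % p + a / p * p) ≡⟨ [m+n]∸[m+o]≡n∸o (b % p) (b / p * p) (a / p * p) ⟩
      b / p * p ∸ a / p * p                     ≡⟨ *-distribʳ-∸ p (b / p) (a / p) ⟨
      (b / p ∸ a / p) * p                       ∎

  ∣∸⇒%-≡ : ∀ {a b} → a ≤ b → p ∣ b ∸ a → a % p ≡ b % p
  ∣∸⇒%-≡ {a} {b} a≤b p∣b∸a = begin
    a % p           ≡⟨ %-remove-+ˡ a p∣b∸a ⟨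
    (b ∸ a + a) % p ≡⟨ cong (_% p) (m∸n+n≡m a≤b) ⟩
    b % p           ∎
    where open ≡-Reasoning

  %-≡-cancelˡ-+ : ∀ v {a b} → (v + a) % p ≡ (v + b) % p → a % p ≡ b % p
  %-≡-cancelˡ-+ v {a} {b} e with ≤-total a b
  ... | inj₁ a≤b = ∣∸⇒%-≡ a≤b (subst (p ∣_) ([m+n]∸[m+o]≡n∸o v b a) (%-≡⇒∣∸ _ _ e))
  ... | inj₂ b≤a = sym (∣∸⇒%-≡ b≤a (subst (p ∣_) ([m+n]∸[m+o]≡n∸o v a b) (%-≡⇒∣∸ _ _ (sym e))))

  -- Indexed by suc (p ∸ 1) rather than p so that the zero residue can be punched out.
  residue : ℕ → Fin (suc (p ∸ 1))
  residue x = fromℕ< (subst (x % p <_) (sym (suc-pred p)) (m%n<n x p))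

  toℕ-residue : ∀ x → toℕ (residue x) ≡ x % p
  toℕ-residue x = toℕ-fromℕ< _

UnitsArePowersOf2 : (p : ℕ) .{{_ : NonZero p}} → ℕ → Set
UnitsArePowersOf2 p b = ∀ r → r % p ≢ 0 → ∃ λ t → 1 ≤ t × t ≤ b × 2 ^ t % p ≡ r % p

unitsArePowersOf2-mono : ∀ {p b b′} .{{_ : NonZero p}} → b ≤ b′ →
                         UnitsArePowersOf2 p b → UnitsArePowersOf2 p b′
unitsArePowersOf2-mono b≤b′ powers r r%p≢0 =
  let t , 1≤t , t≤b , 2^t≡r = powers r r%p≢0 in t , 1≤t , ≤-trans t≤b b≤b′ , 2^t≡r

prime∣2^k⇒≡2 : ∀ {p} k → Prime p → p ∣ 2 ^ k → p ≡ 2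
prime∣2^k⇒≡2 zero    pr p∣1 = contradiction (∣1⇒≡1 p∣1) (nonTrivial⇒≢1 {{prime⇒nonTrivial pr}})
prime∣2^k⇒≡2 (suc k) pr p∣2^[1+k] with euclidsLemma 2 (2 ^ k) pr p∣2^[1+k]
... | inj₂ p∣2^k = prime∣2^k⇒≡2 k pr p∣2^k
... | inj₁ p∣2   with prime⇒irreducible prime[2] p∣2
...   | inj₁ p≡1 = contradiction p≡1 (nonTrivial⇒≢1 {{prime⇒nonTrivial pr}})
...   | inj₂ p≡2 = p≡2

module _ {p : ℕ} .{{_ : NonZero p}} (p-prime : Prime p) (p≢2 : p ≢ 2) where

  2^k%p≢0 : ∀ k → 2 ^ k % p ≢ 0
  2^k%p≢0 k 2^k%p≡0 = p≢2 (prime∣2^k⇒≡2 k p-prime (m%n≡0⇒n∣m _ p 2^k%p≡0))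

  module _ (2-primitive : TwoPrimitiveRootMod p) where

    2^i≡2^[i+d]⇒d≡0 : ∀ i {d} → d < p ∸ 1 → 2 ^ i % p ≡ 2 ^ (i + d) % p → d ≡ 0
    2^i≡2^[i+d]⇒d≡0 i {zero}  _ _ = refl
    2^i≡2^[i+d]⇒d≡0 i {suc d} d<p-1 e with euclidsLemma (2 ^ i) (2 ^ suc d ∸ 1) p-prime p∣2^i*[2^d∸1]
      where
      open ≡-Reasoning
      p∣2^i*[2^d∸1] : p ∣ 2 ^ i * (2 ^ suc d ∸ 1)
      p∣2^i*[2^d∸1] = subst (p ∣_) (begin
        2 ^ (i + suc d) ∸ 2 ^ i           ≡⟨ cong₂ _∸_ (^-distribˡ-+-* 2 i (suc d)) (sym (*-identityʳ (2 ^ i))) ⟩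
        2 ^ i * 2 ^ suc d ∸ 2 ^ i * 1     ≡⟨ *-distribˡ-∸ (2 ^ i) (2 ^ suc d) 1 ⟨
        2 ^ i * (2 ^ suc d ∸ 1)           ∎) (%-≡⇒∣∸ p _ _ e)
    ... | inj₁ p∣2^i     = contradiction (prime∣2^k⇒≡2 i p-prime p∣2^i) p≢2
    ... | inj₂ p∣2^d∸1 = contradiction 2^d%p≡1 (proj₂ 2-primitive (suc d) (s≤s z≤n) d<p-1)
      where
      2^d%p≡1 : 2 ^ suc d % p ≡ 1
      2^d%p≡1 = trans (sym (∣∸⇒%-≡ p (m^n>0 2 (suc d)) p∣2^d∸1))
                      (m<n⇒m%n≡m (nonTrivial⇒n>1 p {{prime⇒nonTrivial p-prime}}))

    2^-%-injective : ∀ {i j} → i ≤ j → j ∸ i < p ∸ 1 → 2 ^ i % p ≡ 2 ^ j % p → i ≡ j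
    2^-%-injective {i} {j} i≤j j∸i<p-1 e = ≤-antisym i≤j (m∸n≡0⇒m≤n j∸i≡0)
      where
      j∸i≡0 : j ∸ i ≡ 0
      j∸i≡0 = 2^i≡2^[i+d]⇒d≡0 i j∸i<p-1 (trans e (cong (λ k → 2 ^ k % p) (sym (m+[n∸m]≡n i≤j))))

    unitsArePowersOf2 : UnitsArePowersOf2 p (p ∸ 1)
    unitsArePowersOf2 r r%p≢0 =
      let k , pow-k≡r = injective⇒hitsAllBut pow-injective 0≢pow 0≢r
      in suc (toℕ k) , s≤s z≤n , toℕ<n k ,
         trans (sym (toℕ-residue p _)) (trans (cong toℕ pow-k≡r) (toℕ-residue p r))
      where
      pow : Fin (p ∸ 1) → Fin (suc (p ∸ 1))
      pow k = residue p (2 ^ suc (toℕ k))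

      pow-injective-≤ : ∀ {k l} → toℕ k ≤ toℕ l → pow k ≡ pow l → k ≡ l
      pow-injective-≤ {k} {l} k≤l pow-k≡pow-l = toℕ-injective (suc-injective
        (2^-%-injective (s≤s k≤l) (≤-<-trans (m∸n≤m (toℕ l) (toℕ k)) (toℕ<n l))
          (trans (sym (toℕ-residue p _)) (trans (cong toℕ pow-k≡pow-l) (toℕ-residue p _)))))

      pow-injective : Injective _≡_ _≡_ pow
      pow-injective {k} {l} pow-k≡pow-l with ≤-total (toℕ k) (toℕ l)
      ... | inj₁ k≤l = pow-injective-≤ k≤l pow-k≡pow-l
      ... | inj₂ l≤k = sym (pow-injective-≤ l≤k (sym pow-k≡pow-l))

      0≢pow : ∀ k → Fin.zero ≢ pow k
      0≢pow k 0≡pow-k = 2^k%p≢0 (suc (toℕ k)) (sym (trans (cong toℕ 0≡pow-k) (toℕ-residue p _)))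

      0≢r : Fin.zero ≢ residue p r
      0≢r 0≡r = r%p≢0 (sym (trans (cong toℕ 0≡r) (toℕ-residue p r)))

module _ {n p c : ℕ} .{{_ : NonZero p}} (p∣n : p ∣ n) (c<p : c < p) where

  c+p*i<n : (i : Fin (n / p)) → c + p * toℕ i < n
  c+p*i<n i = begin-strict
    c + p * toℕ i    <⟨ +-monoˡ-< (p * toℕ i) c<p ⟩
    p + p * toℕ i    ≡⟨ *-suc p (toℕ i) ⟨
    p * suc (toℕ i)  ≤⟨ *-monoʳ-≤ p (toℕ<n i) ⟩
    p * (n / p)      ≡⟨ m*[n/m]≡n p∣n ⟩
    n                ∎
    where open ≤-Reasoning

  classMember : Fin (n / p) → Fin n
  classMember i = fromℕ< (c+p*i<n i)

  toℕ-classMember : ∀ i → toℕ (classMember i) ≡ c + p * toℕ i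
  toℕ-classMember i = toℕ-fromℕ< (c+p*i<n i)

  classMember-injective : Injective _≡_ _≡_ classMember
  classMember-injective {i} {j} e = toℕ-injective (*-cancelˡ-≡ (toℕ i) (toℕ j) p
    (+-cancelˡ-≡ c _ _ (trans (sym (toℕ-classMember i)) (trans (cong toℕ e) (toℕ-classMember j)))))

  residueClass : List (Fin n)
  residueClass = map classMember (allFin (n / p))

  residueClass-unique : Unique residueClass
  residueClass-unique = map⁺ classMember-injective (allFin⁺ (n / p))

  length-residueClass : length residueClass ≡ n / p
  length-residueClass = trans (length-map classMember (allFin (n / p))) (length-tabulate (λ i → i))

  ∈-residueClass : ∀ u → toℕ u % p ≡ c → u ∈ residueClass
  ∈-residueClass u u%p≡c = subst (_∈ residueClass) member-i≡u (∈-map⁺ classMember (∈-allFin i))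
    where
    u/p<n/p : toℕ u / p < n / p
    u/p<n/p = m<n*o⇒m/o<n (subst (toℕ u <_) (sym (m/n*n≡m p∣n)) (toℕ<n u))
    i : Fin (n / p)
    i = fromℕ< u/p<n/p
    open ≡-Reasoning
    member-i≡u : classMember i ≡ u
    member-i≡u = toℕ-injective (begin
      toℕ (classMember i)       ≡⟨ toℕ-classMember i ⟩
      c + p * toℕ i             ≡⟨ cong (λ k → c + p * k) (toℕ-fromℕ< u/p<n/p) ⟩
      c + p * (toℕ u / p)       ≡⟨ cong₂ _+_ (sym u%p≡c) (*-comm p (toℕ u / p)) ⟩
      toℕ u % p + toℕ u / p * p ≡⟨ m≡m%n+[m/n]*n (toℕ u) p ⟨
      toℕ u                     ∎)

module _ {n : ℕ} .{{_ : NonZero n}} where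

  partner : ℕ → Fin n → Fin n
  partner m v = (m + (n ∸ toℕ v)) mod n

  partner-sum : ∀ m v → (toℕ (partner m v) + toℕ v) % n ≡ m % n
  partner-sum m v = begin
    (toℕ (partner m v) + toℕ v) % n           ≡⟨ cong (λ k → (k + toℕ v) % n) (toℕ-fromℕ< (m%n<n x n)) ⟩
    (x % n + toℕ v) % n                       ≡⟨ %-distribˡ-+ (x % n) (toℕ v) n ⟩
    (x % n % n + toℕ v % n) % n               ≡⟨ cong (λ k → (k + toℕ v % n) % n) (m%n%n≡m%n x n) ⟩
    (x % n + toℕ v % n) % n                   ≡⟨ %-distribˡ-+ x (toℕ v) n ⟨
    (m + (n ∸ toℕ v) + toℕ v) % n             ≡⟨ cong (_% n) (+-assoc m (n ∸ toℕ v) (toℕ v)) ⟩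
    (m + (n ∸ toℕ v + toℕ v)) % n             ≡⟨ cong (λ k → (m + k) % n) (m∸n+n≡m (<⇒≤ (toℕ<n v))) ⟩
    (m + n) % n                               ≡⟨ [m+n]%n≡m%n m n ⟩
    m % n                                     ∎
    where
    open ≡-Reasoning
    x : ℕ
    x = m + (n ∸ toℕ v)

module _ {n p c : ℕ} .{{_ : NonZero n}} .{{_ : NonZero p}}
         (p∣n : p ∣ n) (c+[1+c]≡p : c + suc c ≡ p) where

  c<p : c < p
  c<p = subst (c <_) c+[1+c]≡p (m<m+n c z<s)

  residueClass-dominates : UnitsArePowersOf2 p ⌊log₂ n ⌋ →
                           IsDominatingKG n (residueClass p∣n c<p)
  residueClass-dominates powers v with (suc c + toℕ v) % p ≟ 0
  ... | yes 1+c+v≡0 = inj₁ (∈-residueClass p∣n c<p v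
          (trans (%-≡-cancelˡ-+ p (suc c) 1+c+v≡1+c+c) (m<n⇒m%n≡m c<p)))
    where
    1+c+v≡1+c+c : (suc c + toℕ v) % p ≡ (suc c + c) % p
    1+c+v≡1+c+c = trans 1+c+v≡0 (sym (trans (cong (_% p) (trans (+-comm (suc c) c) c+[1+c]≡p)) (n%n≡0 p)))
  ... | no 1+c+v≢0 with t , 1≤t , t≤log₂n , 2^t≡1+c+v ← powers (suc c + toℕ v) 1+c+v≢0 =
    inj₂ (u , ∈-residueClass p∣n c<p u u%p≡c , t , 1≤t , t≤log₂n , partner-sum (2 ^ t ∸ 1) v)
    where
    u : Fin n
    u = partner (2 ^ t ∸ 1) v
    2^t-1≡c+v : (2 ^ t ∸ 1) % p ≡ (c + toℕ v) % p
    2^t-1≡c+v = %-≡-cancelˡ-+ p 1 (trans (cong (_% p) (m+[n∸m]≡n (m^n>0 2 t))) 2^t≡1+c+v)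
    u+v≡2^t-1 : (toℕ u + toℕ v) % p ≡ (2 ^ t ∸ 1) % p
    u+v≡2^t-1 = begin
      (toℕ u + toℕ v) % p      ≡⟨ m∣n⇒o%n%m≡o%m p n (toℕ u + toℕ v) p∣n ⟨
      (toℕ u + toℕ v) % n % p  ≡⟨ cong (_% p) (partner-sum (2 ^ t ∸ 1) v) ⟩
      (2 ^ t ∸ 1) % n % p      ≡⟨ m∣n⇒o%n%m≡o%m p n (2 ^ t ∸ 1) p∣n ⟩
      (2 ^ t ∸ 1) % p          ∎
      where open ≡-Reasoning
    u%p≡c : toℕ u % p ≡ c
    u%p≡c = trans (%-≡-cancelˡ-+ p (toℕ v) (begin
      (toℕ v + toℕ u) % p      ≡⟨ cong (_% p) (+-comm (toℕ v) (toℕ u)) ⟩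
      (toℕ u + toℕ v) % p      ≡⟨ trans u+v≡2^t-1 2^t-1≡c+v ⟩
      (c + toℕ v) % p          ≡⟨ cong (_% p) (+-comm c (toℕ v)) ⟩
      (toℕ v + c) % p          ∎)) (m<n⇒m%n≡m c<p)
      where open ≡-Reasoning

  γKG≤n/p : UnitsArePowersOf2 p ⌊log₂ n ⌋ → γKG≤ n (n / p)
  γKG≤n/p powers = residueClass p∣n c<p , residueClass-unique p∣n c<p ,
                   residueClass-dominates powers , ≤-reflexive (length-residueClass p∣n c<p)

<⌈log₂⌉⇒≤⌊log₂⌋ : ∀ {k n} → k < ⌈log₂ n ⌉ → k ≤ ⌊log₂ n ⌋
<⌈log₂⌉⇒≤⌊log₂⌋ {k} {n} k<⌈log₂n⌉ with 2 ^ k ≤? n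
... | yes 2^k≤n = subst (_≤ ⌊log₂ n ⌋) (⌊log₂[2^n]⌋≡n k) (⌊log₂⌋-mono-≤ 2^k≤n)
... | no  2^k≰n = contradiction
  (subst (⌈log₂ n ⌉ ≤_) (⌈log₂2^n⌉≡n k) (⌈log₂⌉-mono-≤ (<⇒≤ (≰⇒> 2^k≰n)))) (<⇒≱ k<⌈log₂n⌉)

odd-prime⇒half+[1+half]≡ : ∀ {p} → Prime p → p ≢ 2 → p / 2 + suc (p / 2) ≡ p
odd-prime⇒half+[1+half]≡ {p} p-prime p≢2 = begin
  p / 2 + suc (p / 2) ≡⟨ x+[1+x]≡1+x*2 (p / 2) ⟩
  1 + p / 2 * 2       ≡⟨ cong (_+ p / 2 * 2) p%2≡1 ⟨
  p % 2 + p / 2 * 2   ≡⟨ m≡m%n+[m/n]*n p 2 ⟨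
  p                   ∎
  where
  open ≡-Reasoning
  x+[1+x]≡1+x*2 : ∀ x → x + suc x ≡ 1 + x * 2
  x+[1+x]≡1+x*2 = solve-∀
  p%2≢0 : p % 2 ≢ 0
  p%2≢0 p%2≡0 with prime⇒irreducible p-prime (m%n≡0⇒n∣m p 2 p%2≡0)
  ... | inj₁ ()
  ... | inj₂ 2≡p = p≢2 (sym 2≡p)
  p%2≡1 : p % 2 ≡ 1
  p%2≡1 with p % 2 | m%n<n p 2 | p%2≢0
  ... | zero        | _               | p%2≢0 = contradiction refl p%2≢0
  ... | suc zero    | _               | _     = refl
  ... | suc (suc _) | s≤s (s≤s ())    | _

theorem6 : (n : ℕ) .{{_ : NonZero n}} → 6 ≤ n → 2 ∣ n
    → (p : ℕ) .{{_ : NonZero p}} → Prime p → p ≢ 2 → p ∣ n → p ≤ ⌈log₂ n ⌉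
    → TwoPrimitiveRootMod p
    → γKG≤ n (n / p)
theorem6 n _ _ p p-prime p≢2 p∣n p≤⌈log₂n⌉ 2-primitive =
  γKG≤n/p p∣n (odd-prime⇒half+[1+half]≡ p-prime p≢2)
    (unitsArePowersOf2-mono p-1≤⌊log₂n⌋ (unitsArePowersOf2 p-prime p≢2 2-primitive))
  where
  p-1≤⌊log₂n⌋ : p ∸ 1 ≤ ⌊log₂ n ⌋
  p-1≤⌊log₂n⌋ = <⌈log₂⌉⇒≤⌊log₂⌋ {n = n} (subst (_≤ ⌈log₂ n ⌉) (sym (suc-pred p)) p≤⌈log₂n⌉)
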